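{- Let $G$ be a looped simple graph and let $J$ be an independent set of a transverse matroid of $G$. Then there exist a looped simple graph $H$ locally equivalent to $G$ and an induced isomorphism $\beta: M[IAS(G)]\to M[IAS(H)]$ such that $\beta(J)\subseteq\{\phi_H(v)\mid v\in V(H)\}$.
   Context: A looped simple graph is a finite graph with loops allowed but no two edges on the same set of end-vertices; neighbors are distinct adjacent vertices, $N_G(v)$ the open neighborhood. $A(G)$ is the adjacency matrix over $GF(2)$ with diagonal entry $1$ exactly at looped vertices. $IAS(G)=(I\;A(G)\;A(G)+I)$ over $GF(2)$, with $v$ columns labeled $\phi_G(v),\chi_G(v),\psi_G(v)$; $W(G)$ is the set of labels and $M[IAS(G)]$ the binary matroid on $W(G)$ represented by $IAS(G)$. A transversal is a subset of $W(G)$ containing exactly one element of each vertex triple $\{\phi_G(v),\chi_G(v),\psi_G(v)\}$; a transverse matroid is the restriction of $M[IAS(G)]$ to a transversal. Local equivalence: $G^v_\ell$ complements the loop status of $v$; $G^v_s$ complements the adjacency status of every pair of distinct neighbors of $v$; $G^v_{ns}$ does the same and also complements the loop status of every neighbor of $v$. $H$ is locally equivalent to $G$ if obtained from $G$ by a finite sequence of such operations. For $*\in\{\ell,s,ns\}$ there is an isomorphism $\beta^v_*: M[IAS(G)]\to M[IAS(G^v_*)]$ with $\beta^v_*(\alpha_G(x))=\alpha_{G^v_*}(x)$ for all $\alpha\in\{\phi,\chi,\psi\}$, $x\in V(G)$, except: $\beta^v_\ell$ swaps $\chi(v)$ and $\psi(v)$; $\beta^v_{ns}$ sends $\phi_G(v)\mapsto\psi(v)$,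 $\psi_G(v)\mapsto \phi(v)$ if $v$ is unlooped, and $\phi_G(v)\mapsto\chi(v)$, $\chi_G(v)\mapsto\phi(v)$ if $v$ is looped; $\beta^v_s$ has the same exceptions at $v$ as $\beta^v_{ns}$ and additionally, for each $w\in N_G(v)$, $\chi_G(w)\mapsto \psi(w)$ and $\psi_G(w)\mapsto\chi(w)$. An induced isomorphism is a composition of such maps along a sequence of operations transforming $G$ into $H$. -}

module Defs where

open import Data.Bool using (Bool; true; false; _∧_; _xor_; not; if_then_else_)
open import Data.Fin using (Fin; zero; suc; _≟_)
open import Data.Nat using (ℕ; zero; suc)
open import Data.Product using (_×_; _,_; proj₁; proj₂)
open import Relation.Nullary.Decidable using (⌊_⌋)
open import Relation.Binary.PropositionalEquality using (_≡_)
open import Function using (id; _∘_)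

-- Vertices of a graph on n vertices are Fin n.
-- A looped simple graph on Fin n is given by its adjacency matrix over GF(2)
-- (GF(2) = Bool, + = xor, * = ∧); the diagonal entry records the loop.
Mat : ℕ → Set
Mat n = Fin n → Fin n → Bool

LoopedSimple : ∀ {n} → Mat n → Set
LoopedSimple {n} A = (x y : Fin n) → A x y ≡ A y x

_==_ : ∀ {n} → Fin n → Fin n → Bool
x == y = ⌊ x ≟ y ⌋

-- labels of the three columns of IAS(G) belonging to a vertex
data Label : Set where
  φ χ ψ : Label

W : ℕ → Set
W n = Fin n × Label

-- column of IAS(G) = (I  A  A+I) labelled by w, as a function of the row u
column : ∀ {n} → Mat n → W n → Fin n → Bool
column A (v , φ) u = u == v
column A (v , χ) u = A u v
column A (v , ψ) u = A u v xor (u == v)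

Σ₂ : ∀ {n} → (Fin n → Bool) → Bool
Σ₂ {zero} f = false
Σ₂ {suc n} f = f zero xor Σ₂ (f ∘ suc)

Σ₃ : (Label → Bool) → Bool
Σ₃ f = f φ xor (f χ xor f ψ)

ΣW : ∀ {n} → (W n → Bool) → Bool
ΣW f = Σ₂ (λ v → Σ₃ (λ l → f (v , l)))

-- a subset S ⊆ W(G) (as a characteristic function) is independent in
-- M[IAS(G)] iff its columns are linearly independent over GF(2):
-- every GF(2)-linear combination of columns of S that vanishes is trivial.
Independent : ∀ {n} → Mat n → (W n → Bool) → Set
Independent {n} A S =
  (c : W n → Bool) →
  ((w : W n) → c w ≡ true → S w ≡ true) →
  ((u : Fin n) → ΣW (λ w → c w ∧ column A w u) ≡ false) →
  (w : W n) → c w ≡ false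

-- a transversal is given by a choice of a label for each vertex:
-- T = { (v , τ v) | v ∈ V(G) }.
Transversal : ℕ → Set
Transversal n = Fin n → Label

SubsetOfTransversal : ∀ {n} → Transversal n → (W n → Bool) → Set
SubsetOfTransversal {n} τ S = (v : Fin n) (l : Label) → S (v , l) ≡ true → l ≡ τ v

TransverseIndependent : ∀ {n} → Mat n → Transversal n → (W n → Bool) → Set
TransverseIndependent A τ J = SubsetOfTransversal τ J × Independent A J

loopOp : ∀ {n} → Fin n → Mat n → Mat n
loopOp v A x y = A x y xor ((x == v) ∧ (y == v))

nbr : ∀ {n} → Mat n → Fin n → Fin n → Bool
nbr A v x = not (x == v) ∧ A v x

sOp : ∀ {n} → Fin n → Mat n → Mat n
sOp v A x y = A x y xor ((nbr A v x ∧ nbr A v y) ∧ not (x == y))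

-- G^v_ns : as G^v_s and also complement the loop status of each neighbor
nsOp : ∀ {n} → Fin n → Mat n → Mat n
nsOp v A x y = A x y xor (nbr A v x ∧ nbr A v y)

data Op : Set where
  ℓ s ns : Op

applyOp : ∀ {n} → Op → Fin n → Mat n → Mat n
applyOp ℓ  = loopOp
applyOp s  = sOp
applyOp ns = nsOp

swapχψ : Label → Label
swapχψ φ = φ
swapχψ χ = ψ
swapχψ ψ = χ

swapφψ : Label → Label
swapφψ φ = ψ
swapφψ χ = χ
swapφψ ψ = φ

swapφχ : Label → Label
swapφχ φ = χ
swapφχ χ = φ
swapφχ ψ = ψ

atV : ∀ {n} → Mat n → Fin n → Label → Label
atV A v l = if A v v then swapφχ l else swapφψ l

β : ∀ {n} → Op → Fin n → Mat n → W n → W n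
β ℓ  v A (x , l) = x , (if x == v then swapχψ l else l)
β ns v A (x , l) = x , (if x == v then atV A v l else l)
β s  v A (x , l) =
  x , (if x == v then atV A v l
       else (if nbr A v x then swapχψ l else l))

-- LocEq G H f : H is obtained from G by a finite sequence of local
-- operations and f is the induced isomorphism along this sequence.
data LocEq {n : ℕ} (G : Mat n) : Mat n → (W n → W n) → Set where
  done : LocEq G G id
  step : ∀ {H f} → LocEq G H f → (o : Op) (v : Fin n) →
         LocEq G (applyOp o v H) (β o v H ∘ f)

module Submission where

-- The basic fact (column-ns) is that
-- β^v_ns is induced by the elementary row operation on IAS(G) that adds
-- row v to every row u adjacent to v.  Since v is not its own neighbour
-- this operation is invertible, so the image of J stays independent
-- (rowOp-preserves-independence).
--
-- The vertices are then treated one at a time (module Sweep).  Let l be the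
-- label currently carried by the element of J at v.  Either l = φ, or one
-- ns-operation at v turns l into φ, or the column labelled l at v is the
-- neighbourhood column N(v) (column-blocked).  In the last case some
-- neighbour w of v is not yet a φ-element of J: otherwise N(v) would be the
-- sum of the φ-columns of the neighbours (star-relation), contradicting
-- independence.  An ns-operation at w toggles the loop at v, which brings
-- us back to the second case.  No step disturbs a vertex treated earlier,
-- so one sweep over all vertices proves the proposition.

open import Defs
open import Data.Bool using (Bool; true; false; _∧_; _xor_; not; if_then_else_)
open import Data.Bool.Properties
  using (∧-comm; ∧-zeroʳ; ∧-identityʳ; ∧-distribˡ-xor; ∧-distribʳ-xor; xor-comm;
         xor-identityʳ; xor-same; xor-∧-commutativeRing)
import Data.Bool.Properties as Bool using (_≟_)
open import Data.Empty using (⊥-elim)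
open import Data.Fin using (Fin; zero; suc; _≟_)
open import Data.Fin.Properties using (any?; suc-injective)
open import Data.List using (List; []; _∷_; allFin)
open import Data.List.Membership.Propositional using (_∈_)
open import Data.List.Membership.Propositional.Properties using (∈-allFin)
open import Data.List.Relation.Unary.Any using (tail)
open import Data.Maybe using (just; nothing)
open import Data.Nat using (ℕ; zero; suc)
open import Data.Product using (Σ; _×_; _,_; proj₁; proj₂)
open import Data.Sum using (_⊎_; inj₁; inj₂)
open import Function using (id; _∘_)
open import Level using (0ℓ)
open import Relation.Binary.Definitions using (DecidableEquality)
open import Relation.Binary.PropositionalEquality
open import Relation.Nullary using (¬_; Dec; yes; no; _×-dec_; ¬?)
open import Relation.Nullary.Decidable using (⌊_⌋; ⌊⌋-map′)
open import Tactic.RingSolver using (solve-∀)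
open import Tactic.RingSolver.Core.AlmostCommutativeRing
  using (AlmostCommutativeRing; fromCommutativeRing)

GF2 : AlmostCommutativeRing 0ℓ 0ℓ
GF2 = fromCommutativeRing xor-∧-commutativeRing λ { false → just refl ; true → nothing }

xor-interchange : ∀ a b c d → ((a xor b) xor (c xor d)) ≡ ((a xor c) xor (b xor d))
xor-interchange = solve-∀ GF2

xor-swapʳ : ∀ a b c → ((a xor b) xor c) ≡ ((a xor c) xor b)
xor-swapʳ = solve-∀ GF2

∧-distrib-row : ∀ c k m k′ → (c ∧ (k xor (m ∧ k′))) ≡ ((c ∧ k) xor (m ∧ (c ∧ k′)))
∧-distrib-row = solve-∀ GF2

true≢false : true ≢ false
true≢false ()

==-refl : ∀ {n} (v : Fin n) → (v == v) ≡ true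
==-refl v with v ≟ v
... | yes _   = refl
... | no v≢v = ⊥-elim (v≢v refl)

==-≢ : ∀ {n} {x v : Fin n} → x ≢ v → (x == v) ≡ false
==-≢ {x = x} {v} x≢v with x ≟ v
... | yes x≡v = ⊥-elim (x≢v x≡v)
... | no _    = refl

==-sym : ∀ {n} (x v : Fin n) → (x == v) ≡ (v == x)
==-sym x v with x ≟ v | v ≟ x
... | yes _   | yes _   = refl
... | no _    | no _    = refl
... | yes x≡v | no v≢x = ⊥-elim (v≢x (sym x≡v))
... | no x≢v  | yes v≡x = ⊥-elim (x≢v (sym v≡x))

suc-== : ∀ {n} (x v : Fin n) → (suc x == suc v) ≡ (x == v)
suc-== x v = ⌊⌋-map′ (cong suc) suc-injective (x ≟ v)

Σ₂-cong : ∀ {n} {f g : Fin n → Bool} → (∀ x → f x ≡ g x) → Σ₂ f ≡ Σ₂ g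
Σ₂-cong {zero}  f≗g = refl
Σ₂-cong {suc n} f≗g = cong₂ _xor_ (f≗g zero) (Σ₂-cong (f≗g ∘ suc))

Σ₂-xor : ∀ {n} (f g : Fin n → Bool) → Σ₂ (λ x → f x xor g x) ≡ (Σ₂ f xor Σ₂ g)
Σ₂-xor {zero}  f g = refl
Σ₂-xor {suc n} f g =
  trans (cong ((f zero xor g zero) xor_) (Σ₂-xor (f ∘ suc) (g ∘ suc)))
        (xor-interchange (f zero) (g zero) (Σ₂ (f ∘ suc)) (Σ₂ (g ∘ suc)))

Σ₂-scale : ∀ {n} b (f : Fin n → Bool) → Σ₂ (λ x → b ∧ f x) ≡ (b ∧ Σ₂ f)
Σ₂-scale {zero}  b f = sym (∧-zeroʳ b)
Σ₂-scale {suc n} b f =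
  trans (cong ((b ∧ f zero) xor_) (Σ₂-scale b (f ∘ suc)))
        (sym (∧-distribˡ-xor b (f zero) (Σ₂ (f ∘ suc))))

Σ₂-δ : ∀ {n} (v : Fin n) (g : Fin n → Bool) → Σ₂ (λ x → (x == v) ∧ g x) ≡ g v
Σ₂-δ zero    g = trans (cong (g zero xor_) (Σ₂-scale false (g ∘ suc))) (xor-identityʳ (g zero))
Σ₂-δ (suc v) g = trans (Σ₂-cong (λ x → cong (_∧ g (suc x)) (suc-== x v))) (Σ₂-δ v (g ∘ suc))

Σ₃-cong : {f g : Label → Bool} → (∀ l → f l ≡ g l) → Σ₃ f ≡ Σ₃ g
Σ₃-cong f≗g = cong₂ _xor_ (f≗g φ) (cong₂ _xor_ (f≗g χ) (f≗g ψ))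

Σ₃-xor : (f g : Label → Bool) → Σ₃ (λ l → f l xor g l) ≡ (Σ₃ f xor Σ₃ g)
Σ₃-xor f g =
  trans (cong ((f φ xor g φ) xor_) (xor-interchange (f χ) (g χ) (f ψ) (g ψ)))
        (xor-interchange (f φ) (g φ) (f χ xor f ψ) (g χ xor g ψ))

Σ₃-scale : ∀ b (f : Label → Bool) → Σ₃ (λ l → b ∧ f l) ≡ (b ∧ Σ₃ f)
Σ₃-scale b f =
  trans (cong ((b ∧ f φ) xor_) (sym (∧-distribˡ-xor b (f χ) (f ψ))))
        (sym (∧-distribˡ-xor b (f φ) (f χ xor f ψ)))

ΣW-cong : ∀ {n} {f g : W n → Bool} → (∀ w → f w ≡ g w) → ΣW f ≡ ΣW g
ΣW-cong f≗g = Σ₂-cong (λ v → Σ₃-cong (λ l → f≗g (v , l)))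

ΣW-xor : ∀ {n} (f g : W n → Bool) → ΣW (λ w → f w xor g w) ≡ (ΣW f xor ΣW g)
ΣW-xor f g =
  trans (Σ₂-cong (λ v → Σ₃-xor (λ l → f (v , l)) (λ l → g (v , l))))
        (Σ₂-xor (λ v → Σ₃ (λ l → f (v , l))) (λ v → Σ₃ (λ l → g (v , l))))

ΣW-scale : ∀ {n} b (f : W n → Bool) → ΣW (λ w → b ∧ f w) ≡ (b ∧ ΣW f)
ΣW-scale b f =
  trans (Σ₂-cong (λ v → Σ₃-scale b (λ l → f (v , l))))
        (Σ₂-scale b (λ v → Σ₃ (λ l → f (v , l))))

_≟ᴸ_ : DecidableEquality Label
φ ≟ᴸ φ = yes refl
χ ≟ᴸ χ = yes refl
ψ ≟ᴸ ψ = yes refl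
φ ≟ᴸ χ = no λ ()
φ ≟ᴸ ψ = no λ ()
χ ≟ᴸ φ = no λ ()
χ ≟ᴸ ψ = no λ ()
ψ ≟ᴸ φ = no λ ()
ψ ≟ᴸ χ = no λ ()

onTransversal : ∀ {n} → Transversal n → (Fin n → Bool) → W n → Bool
onTransversal τ X (x , l) = ⌊ l ≟ᴸ τ x ⌋ ∧ X x

onTransversal-self : ∀ {n} (τ : Transversal n) X x → X x ≡ true → onTransversal τ X (x , τ x) ≡ true
onTransversal-self τ X x Xx with τ x ≟ᴸ τ x
... | yes _    = Xx
... | no τx≢τx = ⊥-elim (τx≢τx refl)

onTransversal-member : ∀ {n} (τ : Transversal n) X x l →
  onTransversal τ X (x , l) ≡ true → l ≡ τ x × X x ≡ true
onTransversal-member τ X x l member with l ≟ᴸ τ x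
... | yes l≡τx = l≡τx , member

ΣW-onTransversal : ∀ {n} (τ : Transversal n) X (g : W n → Bool) →
  ΣW (λ w → onTransversal τ X w ∧ g w) ≡ Σ₂ (λ x → X x ∧ g (x , τ x))
ΣW-onTransversal τ X g = Σ₂-cong (λ x → select (τ x) (X x) (λ l → g (x , l)))
  where
  select : ∀ t b (h : Label → Bool) → Σ₃ (λ l → (⌊ l ≟ᴸ t ⌋ ∧ b) ∧ h l) ≡ (b ∧ h t)
  select φ b h = xor-identityʳ (b ∧ h φ)
  select χ b h = xor-identityʳ (b ∧ h χ)
  select ψ b h = refl

IndependentOn : ∀ {n} → (W n → Fin n → Bool) → (W n → Bool) → Set
IndependentOn {n} K S =
  (c : W n → Bool) → ((w : W n) → c w ≡ true → S w ≡ true) →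
  ((u : Fin n) → ΣW (λ w → c w ∧ K w u) ≡ false) → (w : W n) → c w ≡ false

IndependentOn-resp : ∀ {n} {K K′ : W n → Fin n → Bool} {S} →
  (∀ w u → K w u ≡ K′ w u) → IndependentOn K S → IndependentOn K′ S
IndependentOn-resp K≗K′ independent c c⊆S relation =
  independent c c⊆S (λ u → trans (ΣW-cong (λ w → cong (c w ∧_) (K≗K′ w u))) (relation u))

rowOp : ∀ {n} → Fin n → (Fin n → Bool) → (Fin n → Bool) → Fin n → Bool
rowOp v N col u = col u xor (N u ∧ col v)

-- if N v = false the row operation is an involution, so it preserves
-- linear independence
rowOp-preserves-independence : ∀ {n} {K : W n → Fin n → Bool} {S} v N → N v ≡ false →
  IndependentOn K S → IndependentOn (λ w → rowOp v N (K w)) S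
rowOp-preserves-independence {n} {K} v N Nv≡false independent c c⊆S relation =
  independent c c⊆S before≡0
  where
  open ≡-Reasoning
  before : Fin n → Bool
  before u = ΣW (λ w → c w ∧ K w u)

  after≡ : ∀ u → ΣW (λ w → c w ∧ rowOp v N (K w) u) ≡ (before u xor (N u ∧ before v))
  after≡ u = begin
    ΣW (λ w → c w ∧ (K w u xor (N u ∧ K w v)))
      ≡⟨ ΣW-cong (λ w → ∧-distrib-row (c w) (K w u) (N u) (K w v)) ⟩
    ΣW (λ w → (c w ∧ K w u) xor (N u ∧ (c w ∧ K w v)))
      ≡⟨ ΣW-xor (λ w → c w ∧ K w u) (λ w → N u ∧ (c w ∧ K w v)) ⟩
    before u xor ΣW (λ w → N u ∧ (c w ∧ K w v))
      ≡⟨ cong (before u xor_) (ΣW-scale (N u) (λ w → c w ∧ K w v)) ⟩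
    before u xor (N u ∧ before v) ∎

  before-v≡0 : before v ≡ false
  before-v≡0 = begin
    before v                       ≡⟨ sym (xor-identityʳ (before v)) ⟩
    before v xor false             ≡⟨ cong (λ b → before v xor (b ∧ before v)) (sym Nv≡false) ⟩
    before v xor (N v ∧ before v)  ≡⟨ sym (after≡ v) ⟩
    _                              ≡⟨ relation v ⟩
    false                          ∎

  before≡0 : ∀ u → before u ≡ false
  before≡0 u = begin
    before u                       ≡⟨ sym (xor-identityʳ (before u)) ⟩
    before u xor false             ≡⟨ cong (before u xor_) (sym (∧-zeroʳ (N u))) ⟩
    before u xor (N u ∧ false)     ≡⟨ cong (λ b → before u xor (N u ∧ b)) (sym before-v≡0) ⟩
    before u xor (N u ∧ before v)  ≡⟨ sym (after≡ u) ⟩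
    _                              ≡⟨ relation u ⟩
    false                          ∎

-- the closed neighbourhood {v} ∪ N of v (for N v = false)
star : ∀ {n} → Fin n → (Fin n → Bool) → Fin n → Bool
star v N x = (x == v) xor N x

star-relation : ∀ {n} (K : Fin n → Fin n → Bool) v (N : Fin n → Bool) →
  (∀ u → K v u ≡ N u) → (∀ x → N x ≡ true → ∀ u → K x u ≡ (u == x)) →
  ∀ u → Σ₂ (λ x → star v N x ∧ K x u) ≡ false
star-relation K v N centre leaf u = begin
  Σ₂ (λ x → star v N x ∧ K x u)
    ≡⟨ Σ₂-cong (λ x → ∧-distribʳ-xor (K x u) (x == v) (N x)) ⟩
  Σ₂ (λ x → ((x == v) ∧ K x u) xor (N x ∧ K x u))
    ≡⟨ Σ₂-xor (λ x → (x == v) ∧ K x u) (λ x → N x ∧ K x u) ⟩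
  Σ₂ (λ x → (x == v) ∧ K x u) xor Σ₂ (λ x → N x ∧ K x u)
    ≡⟨ cong₂ _xor_ (trans (Σ₂-δ v (λ x → K x u)) (centre u))
                   (trans (Σ₂-cong leaf-term) (Σ₂-δ u N)) ⟩
  N u xor N u
    ≡⟨ xor-same (N u) ⟩
  false ∎
  where
  open ≡-Reasoning
  leaf-term : ∀ x → (N x ∧ K x u) ≡ ((x == u) ∧ N x)
  leaf-term x with N x in Nx
  ... | false = sym (∧-zeroʳ (x == u))
  ... | true  = trans (leaf x Nx u) (trans (==-sym u x) (sym (∧-identityʳ (x == u))))

nbr-irrefl : ∀ {n} (A : Mat n) v → nbr A v v ≡ false
nbr-irrefl A v rewrite ==-refl v = refl

nbr-off : ∀ {n} (A : Mat n) {x v} → x ≢ v → nbr A v x ≡ A v x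
nbr-off A x≢v rewrite ==-≢ x≢v = refl

nbr-sym : ∀ {n} {A : Mat n} → LoopedSimple A → ∀ v w → nbr A v w ≡ nbr A w v
nbr-sym simple v w = cong₂ _∧_ (cong not (==-sym w v)) (simple v w)

nsOp-simple : ∀ {n} {A : Mat n} → LoopedSimple A → ∀ v → LoopedSimple (nsOp v A)
nsOp-simple {A = A} simple v x y = cong₂ _xor_ (simple x y) (∧-comm (nbr A v x) (nbr A v y))

nsOp-fixes-column : ∀ {n} (A : Mat n) v u → nsOp v A u v ≡ A u v
nsOp-fixes-column A v u rewrite nbr-irrefl A v | ∧-zeroʳ (nbr A v u) = xor-identityʳ (A u v)

nsOp-toggles-loop : ∀ {n} (A : Mat n) {w v} → nbr A w v ≡ true → nsOp w A v v ≡ not (A v v)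
nsOp-toggles-loop A {w} {v} adjacent rewrite adjacent = xor-comm (A v v) true

nsLabel : Bool → Label → Label
nsLabel h l = if h then swapφχ l else swapφψ l

nsLabel-trichotomy : ∀ h l → l ≡ φ ⊎ nsLabel h l ≡ φ ⊎ nsLabel (not h) l ≡ φ
nsLabel-trichotomy h     φ = inj₁ refl
nsLabel-trichotomy true  χ = inj₂ (inj₁ refl)
nsLabel-trichotomy false χ = inj₂ (inj₂ refl)
nsLabel-trichotomy true  ψ = inj₂ (inj₂ refl)
nsLabel-trichotomy false ψ = inj₂ (inj₁ refl)

entry : Label → Bool → Bool → Bool
entry φ p a = p
entry χ p a = a
entry ψ p a = a xor p

column-entry : ∀ {n} (A : Mat n) x l u → column A (x , l) u ≡ entry l (u == x) (A u x)
column-entry A x φ u = refl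
column-entry A x χ u = refl
column-entry A x ψ u = refl

entry-affine : ∀ l a R N K → entry l a (R xor (N ∧ K)) ≡ (entry l a R xor (N ∧ entry l false K))
entry-affine φ a R N K = sym (trans (cong (a xor_) (∧-zeroʳ N)) (xor-identityʳ a))
entry-affine χ a R N K = refl
entry-affine ψ a R N K =
  trans (xor-swapʳ R (N ∧ K) a) (cong (λ k → (R xor a) xor (N ∧ k)) (sym (xor-identityʳ K)))

entry-ns-diagonal : ∀ h l → entry (nsLabel h l) true h ≡ entry l true h
entry-ns-diagonal true  φ = refl
entry-ns-diagonal false φ = refl
entry-ns-diagonal true  χ = refl
entry-ns-diagonal false χ = refl
entry-ns-diagonal true  ψ = refl
entry-ns-diagonal false ψ = refl

entry-ns-offdiagonal : ∀ h l N → entry (nsLabel h l) false N ≡ (entry l false N xor (N ∧ entry l true h))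
entry-ns-offdiagonal true  φ true  = refl
entry-ns-offdiagonal true  φ false = refl
entry-ns-offdiagonal false φ true  = refl
entry-ns-offdiagonal false φ false = refl
entry-ns-offdiagonal true  χ true  = refl
entry-ns-offdiagonal true  χ false = refl
entry-ns-offdiagonal false χ true  = refl
entry-ns-offdiagonal false χ false = refl
entry-ns-offdiagonal true  ψ true  = refl
entry-ns-offdiagonal true  ψ false = refl
entry-ns-offdiagonal false ψ true  = refl
entry-ns-offdiagonal false ψ false = refl

β-ns-self : ∀ {n} (A : Mat n) v l → β ns v A (v , l) ≡ (v , nsLabel (A v v) l)
β-ns-self A v l rewrite ==-refl v = refl

β-ns-other : ∀ {n} (A : Mat n) {x v} l → x ≢ v → β ns v A (x , l) ≡ (x , l)
β-ns-other A l x≢v rewrite ==-≢ x≢v = refl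

column-ns-other : ∀ {n} (A : Mat n) {x v} l u → x ≢ v →
  column (nsOp v A) (x , l) u ≡ rowOp v (nbr A v) (column A (x , l)) u
column-ns-other A {x} {v} l u x≢v = begin
  column (nsOp v A) (x , l) u
    ≡⟨ column-entry (nsOp v A) x l u ⟩
  entry l (u == x) (A u x xor (nbr A v u ∧ nbr A v x))
    ≡⟨ cong (λ k → entry l (u == x) (A u x xor (nbr A v u ∧ k))) (nbr-off A x≢v) ⟩
  entry l (u == x) (A u x xor (nbr A v u ∧ A v x))
    ≡⟨ entry-affine l (u == x) (A u x) (nbr A v u) (A v x) ⟩
  entry l (u == x) (A u x) xor (nbr A v u ∧ entry l false (A v x))
    ≡⟨ cong (λ b → entry l (u == x) (A u x) xor (nbr A v u ∧ entry l b (A v x)))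
            (sym (==-≢ (≢-sym x≢v))) ⟩
  entry l (u == x) (A u x) xor (nbr A v u ∧ entry l (v == x) (A v x))
    ≡⟨ sym (cong₂ (λ p q → p xor (nbr A v u ∧ q)) (column-entry A x l u) (column-entry A x l v)) ⟩
  rowOp v (nbr A v) (column A (x , l)) u ∎
  where open ≡-Reasoning

column-ns-self : ∀ {n} (A : Mat n) → LoopedSimple A → ∀ v l u →
  column (nsOp v A) (v , nsLabel (A v v) l) u ≡ rowOp v (nbr A v) (column A (v , l)) u
column-ns-self A simple v l u = begin
  column (nsOp v A) (v , nsLabel (A v v) l) u
    ≡⟨ column-entry (nsOp v A) v (nsLabel (A v v) l) u ⟩
  entry (nsLabel (A v v) l) (u == v) (nsOp v A u v)
    ≡⟨ cong (entry (nsLabel (A v v) l) (u == v)) (nsOp-fixes-column A v u) ⟩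
  entry (nsLabel (A v v) l) (u == v) (A u v)
    ≡⟨ row-u ⟩
  entry l (u == v) (A u v) xor (nbr A v u ∧ entry l true (A v v))
    ≡⟨ sym (cong₂ (λ p q → p xor (nbr A v u ∧ q)) (column-entry A v l u)
                  (trans (column-entry A v l v) (cong (λ b → entry l b (A v v)) (==-refl v)))) ⟩
  rowOp v (nbr A v) (column A (v , l)) u ∎
  where
  open ≡-Reasoning
  row-u : entry (nsLabel (A v v) l) (u == v) (A u v)
          ≡ (entry l (u == v) (A u v) xor (nbr A v u ∧ entry l true (A v v)))
  row-u with u ≟ v
  ... | yes refl = trans (entry-ns-diagonal (A u u) l) (sym (xor-identityʳ (entry l true (A u u))))
  ... | no _ rewrite simple u v = entry-ns-offdiagonal (A v v) l (A v u)

column-ns : ∀ {n} (A : Mat n) → LoopedSimple A → ∀ v w u →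
  column (nsOp v A) (β ns v A w) u ≡ rowOp v (nbr A v) (column A w) u
column-ns A simple v (x , l) u with x ≟ v
... | no x≢v  = column-ns-other A l u x≢v
... | yes refl = column-ns-self A simple x l u

column-blocked : ∀ {n} (A : Mat n) → LoopedSimple A → ∀ v l →
  nsLabel (not (A v v)) l ≡ φ → ∀ u → column A (v , l) u ≡ nbr A v u
column-blocked A simple v l blocked u = trans (column-entry A v l u) row-u
  where
  row-u : entry l (u == v) (A u v) ≡ nbr A v u
  row-u with u ≟ v
  ... | yes refl = diagonal (A u u) l blocked
    where
    diagonal : ∀ h l → nsLabel (not h) l ≡ φ → entry l true h ≡ false
    diagonal false χ _ = refl
    diagonal true  ψ _ = refl
  ... | no _ rewrite simple u v = offdiagonal (A v v) l (A v u) blocked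
    where
    offdiagonal : ∀ h l N → nsLabel (not h) l ≡ φ → entry l false N ≡ N
    offdiagonal false χ N _ = refl
    offdiagonal true  ψ N _ = xor-identityʳ N

module Sweep {n : ℕ} (G : Mat n) (G-simple : LoopedSimple G) (τ : Transversal n)
             (J : W n → Bool) (J⊆τ : SubsetOfTransversal τ J) (J-independent : Independent G J)
             where

  record Reached : Set where
    constructor reached
    field
      H              : Mat n
      f              : W n → W n
      simple         : LoopedSimple H
      path           : LocEq G H f
      fixes-vertices : ∀ w → proj₁ (f w) ≡ proj₁ w
      independent    : IndependentOn (λ w → column H (f w)) J
  open Reached public

  start : Reached
  start = reached G id G-simple done (λ _ → refl) J-independent

  nsAt : Reached → Fin n → Reached
  nsAt σ v = reached
    (nsOp v (H σ)) (β ns v (H σ) ∘ f σ) (nsOp-simple (simple σ) v) (step (path σ) ns v)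
    (fixes-vertices σ)
    (IndependentOn-resp (λ w u → sym (column-ns (H σ) (simple σ) v (f σ w) u))
      (rowOp-preserves-independence {K = λ w → column (H σ) (f σ w)}
        v (nbr (H σ) v) (nbr-irrefl (H σ) v) (independent σ)))

  label : Reached → Fin n → Label
  label σ x = proj₂ (f σ (x , τ x))

  image : ∀ σ x → f σ (x , τ x) ≡ (x , label σ x)
  image σ x = cong (_, label σ x) (fixes-vertices σ (x , τ x))

  label-nsAt-self : ∀ σ v → label (nsAt σ v) v ≡ nsLabel (H σ v v) (label σ v)
  label-nsAt-self σ v =
    cong proj₂ (trans (cong (β ns v (H σ)) (image σ v)) (β-ns-self (H σ) v (label σ v)))

  label-nsAt-other : ∀ σ {x v} → x ≢ v → label (nsAt σ v) x ≡ label σ x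
  label-nsAt-other σ {x} {v} x≢v =
    cong proj₂ (trans (cong (β ns v (H σ)) (image σ x)) (β-ns-other (H σ) (label σ x) x≢v))

  Settled : Reached → Fin n → Set
  Settled σ x = J (x , τ x) ≡ true → label σ x ≡ φ

  Progress : Reached → Fin n → Set
  Progress σ v = Σ Reached λ σ′ → Settled σ′ v × (∀ x → x ≢ v → Settled σ x → Settled σ′ x)

  stay : ∀ σ v → Settled σ v → Progress σ v
  stay σ v settled = σ , settled , λ _ _ s → s

  progress-after : ∀ σ σ₁ {v} → (∀ x → Settled σ x → Settled σ₁ x) → Progress σ₁ v → Progress σ v
  progress-after σ σ₁ keeps₁ (σ′ , settled , keeps) = σ′ , settled , λ x x≢v s → keeps x x≢v (keeps₁ x s)

  settle-directly : ∀ σ v → nsLabel (H σ v v) (label σ v) ≡ φ → Progress σ v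
  settle-directly σ v becomes-φ =
    nsAt σ v , (λ _ → trans (label-nsAt-self σ v) becomes-φ) ,
    λ x x≢v settled Jx → trans (label-nsAt-other σ x≢v) (settled Jx)

  Finished : Reached → Fin n → Set
  Finished σ w = J (w , τ w) ≡ true × label σ w ≡ φ

  finished? : ∀ σ w → Dec (Finished σ w)
  finished? σ w = (J (w , τ w) Bool.≟ true) ×-dec (label σ w ≟ᴸ φ)

  -- a blocked vertex of J cannot have only finished neighbours: the columns
  -- over its star would be dependent
  blocked-has-unfinished-neighbour : ∀ σ v → J (v , τ v) ≡ true →
    nsLabel (not (H σ v v)) (label σ v) ≡ φ →
    ¬ (∀ w → nbr (H σ) v w ≡ true → Finished σ w)
  blocked-has-unfinished-neighbour σ v Jv blocked finished =
    true≢false (trans (sym in-star) (independent σ c c⊆J relation (v , τ v)))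
    where
    N : Fin n → Bool
    N = nbr (H σ) v

    c : W n → Bool
    c = onTransversal τ (star v N)

    in-star : c (v , τ v) ≡ true
    in-star = onTransversal-self τ (star v N) v
                (cong₂ _xor_ (==-refl v) (nbr-irrefl (H σ) v))

    c⊆J : ∀ w → c w ≡ true → J w ≡ true
    c⊆J (x , l) member with onTransversal-member τ (star v N) x l member
    ... | refl , x∈star = star-in-J x x∈star
      where
      star-in-J : ∀ x → star v N x ≡ true → J (x , τ x) ≡ true
      star-in-J x x∈star with x ≟ v
      ... | yes refl = Jv
      ... | no x≢v   = proj₁ (finished x (trans (nbr-off (H σ) x≢v) x∈star))

    K : Fin n → Fin n → Bool
    K x = column (H σ) (f σ (x , τ x))

    centre : ∀ u → K v u ≡ N u
    centre u = trans (cong (λ w → column (H σ) w u) (image σ v))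
                     (column-blocked (H σ) (simple σ) v (label σ v) blocked u)

    leaf : ∀ x → N x ≡ true → ∀ u → K x u ≡ (u == x)
    leaf x adjacent u =
      cong (λ w → column (H σ) w u) (trans (image σ x) (cong (x ,_) (proj₂ (finished x adjacent))))

    relation : ∀ u → ΣW (λ w → c w ∧ column (H σ) (f σ w) u) ≡ false
    relation u = trans (ΣW-onTransversal τ (star v N) (λ w → column (H σ) (f σ w) u))
                       (star-relation K v N centre leaf u)

  -- a blocked vertex is unblocked by an ns-operation at an unfinished
  -- neighbour, which toggles its loop
  settle-blocked : ∀ σ v → J (v , τ v) ≡ true → nsLabel (not (H σ v v)) (label σ v) ≡ φ →
    Progress σ v
  settle-blocked σ v Jv blocked
    with any? (λ w → (nbr (H σ) v w Bool.≟ true) ×-dec ¬? (finished? σ w))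
  ... | no none = ⊥-elim (blocked-has-unfinished-neighbour σ v Jv blocked all-finished)
    where
    all-finished : ∀ w → nbr (H σ) v w ≡ true → Finished σ w
    all-finished w adjacent with finished? σ w
    ... | yes fin       = fin
    ... | no unfinished = ⊥-elim (none (w , adjacent , unfinished))
  ... | yes (w , adjacent , unfinished) =
    progress-after σ σ₁ σ₁-keeps (settle-directly σ₁ v unblocked)
    where
    σ₁ : Reached
    σ₁ = nsAt σ w

    v≢w : v ≢ w
    v≢w refl = true≢false (trans (sym adjacent) (nbr-irrefl (H σ) v))

    loop-toggled : H σ₁ v v ≡ not (H σ v v)
    loop-toggled = nsOp-toggles-loop (H σ) (trans (nbr-sym (simple σ) w v) adjacent)

    unblocked : nsLabel (H σ₁ v v) (label σ₁ v) ≡ φ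
    unblocked = subst₂ (λ h l → nsLabel h l ≡ φ) (sym loop-toggled)
                       (sym (label-nsAt-other σ v≢w)) blocked

    -- only w changes its label, and w was not settled with a J-element
    σ₁-keeps : ∀ x → Settled σ x → Settled σ₁ x
    σ₁-keeps x settled Jx with x ≟ w
    ... | yes refl = ⊥-elim (unfinished (Jx , settled Jx))
    ... | no x≢w   = trans (label-nsAt-other σ x≢w) (settled Jx)

  settle : ∀ σ v → Progress σ v
  settle σ v with J (v , τ v) Bool.≟ true
  ... | no ¬Jv = stay σ v (λ Jv → ⊥-elim (¬Jv Jv))
  ... | yes Jv with nsLabel-trichotomy (H σ v v) (label σ v)
  ...   | inj₁ is-φ              = stay σ v (λ _ → is-φ)
  ...   | inj₂ (inj₁ becomes-φ)  = settle-directly σ v becomes-φ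
  ...   | inj₂ (inj₂ blocked)    = settle-blocked σ v Jv blocked

  sweep : (L : List (Fin n)) → Σ Reached λ σ → ∀ x → x ∈ L → Settled σ x
  sweep []      = start , λ _ ()
  sweep (v ∷ L) with sweep L
  ... | σ , settled-L with settle σ v
  ...   | σ′ , settled-v , keeps = σ′ , settled
    where
    settled : ∀ x → x ∈ v ∷ L → Settled σ′ x
    settled x x∈vL with x ≟ v
    ... | yes refl = settled-v
    ... | no x≢v   = keeps x x≢v (settled-L x (tail x≢v x∈vL))

  φ-labelled : ∀ σ → (∀ x → Settled σ x) → ∀ w → J w ≡ true → proj₂ (f σ w) ≡ φ
  φ-labelled σ settled (x , l) Jw with J⊆τ x l Jw
  ... | refl = settled x Jw

proposition38 : (n : ℕ) (G : Mat n) → LoopedSimple G →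
    (τ : Transversal n) (J : W n → Bool) → TransverseIndependent G τ J →
    Σ (Mat n) λ H → Σ (W n → W n) λ f →
      LoopedSimple H × LocEq G H f ×
      ((w : W n) → J w ≡ true → proj₂ (f w) ≡ φ)
proposition38 n G G-simple τ J (J⊆τ , J-independent) =
  H σ , f σ , simple σ , path σ , φ-labelled σ (λ x → settled x (∈-allFin x))
  where
  open Sweep G G-simple τ J J⊆τ J-independent
  swept : Σ Reached λ σ → ∀ x → x ∈ allFin n → Settled σ x
  swept = sweep (allFin n)

  σ : Reached
  σ = proj₁ swept

  settled : ∀ x → x ∈ allFin n → Settled σ x
  settled = proj₂ swept
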